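{- The calculus $\mathcal R\mathrm{PL}_0$ is sound and refutationally complete: (1) every rule of $\mathcal R\mathrm{PL}_0$ is sound, i.e. every model of the premise(s) is a model of the conclusion; and (2) for every quantifier-free first-order formula $F$ such that $\forall F$ is unsatisfiable, there is an $\mathcal R\mathrm{PL}_0$-derivation of the empty sequent $\vdash$ from axioms of the form $\vdash F\vartheta$, where each $\vartheta$ is a renaming of the variables of $F$.
   Context: $\mathrm{PL}_0$ is the set of quantifier-free first-order formulas built with $\neg,\wedge,\vee$. Sequents are objects $\Gamma\vdash\Delta$ with $\Gamma,\Delta$ finite multisets of formulas in $\mathrm{PL}_0$; a sequent is true in a structure if the universal closure of $\bigwedge\Gamma\to\bigvee\Delta$ holds. The calculus $\mathcal R\mathrm{PL}_0$ has as axioms all sequents $\vdash F$ with $F\in\mathrm{PL}_0$ and the following rules (premise $\Rightarrow$ conclusion): $\Gamma\vdash\Delta,A\wedge B\Rightarrow\Gamma\vdash\Delta,A$; $\Gamma\vdash\Delta,A\wedge B\Rightarrow\Gamma\vdash\Delta,B$; $A\wedge B,\Gamma\vdash\Delta\Rightarrow A,B,\Gamma\vdash\Delta$; $\Gamma\vdash\Delta,A\vee B\Rightarrow\Gamma\vdash\Delta,A,B$; $A\vee B,\Gamma\vdash\Delta\Rightarrow A,\Gamma\vdash\Delta$; $A\vee B,\Gamma\vdash\Delta\Rightarrow B,\Gamma\vdash\Delta$; $\Gamma\vdash\Delta,\neg A\Rightarrow A,\Gamma\vdash\Delta$; $\neg A,\Gamma\vdash\Delta\Rightarrow\Gamma\vdash\Delta,A$;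 and the resolution rule: from $\Gamma\vdash\Delta,A_1,\dots,A_k$ and $B_1,\dots,B_l,\Pi\vdash\Lambda$, where the variables of $\{A_1,\dots,A_k\}$ and of $\{B_1,\dots,B_l\}$ are disjoint and $\vartheta$ is a most general unifier of $\{A_1,\dots,A_k,B_1,\dots,B_l\}$, infer $\Gamma\vartheta,\Pi\vartheta\vdash\Delta\vartheta,\Lambda\vartheta$ (the formulas $A_i,B_j$ need not be atomic). -}

module Defs where

open import Level using (0ℓ)
open import Data.Nat using (ℕ)
open import Data.Bool using (Bool; true; false; not; _∧_; _∨_)
open import Data.List using (List; []; _∷_; _++_; map; [_])
open import Data.List.Relation.Unary.All using (All)
open import Data.List.Relation.Unary.Any using (Any)
open import Data.List.Membership.Propositional using (_∈_; _∉_)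
open import Data.List.Relation.Binary.Permutation.Propositional using (_↭_)
open import Data.Product using (Σ; _×_; _,_; ∃)
open import Relation.Binary.PropositionalEquality using (_≡_)
open import Relation.Nullary using (¬_)
open import Function using (_∘_)
open import Function.Definitions using (Injective)

-- Variables, function symbols and predicate symbols are named
-- by natural numbers; the arity of a symbol occurrence is the length of
-- its argument list (so a symbol is really a pair name/arity).

data Term : Set where
  var : ℕ → Term
  fun : ℕ → List Term → Term

data Fml : Set where
  atom  : ℕ → List Term → Fml
  ¬ᶠ_   : Fml → Fml
  _∧ᶠ_  : Fml → Fml → Fml
  _∨ᶠ_  : Fml → Fml → Fml

infix  6 ¬ᶠ_
infixr 5 _∧ᶠ_
infixr 4 _∨ᶠ_

Subst : Set
Subst = ℕ → Term

mutual
  _⟨_⟩ₜ : Term → Subst → Term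
  var x    ⟨ σ ⟩ₜ = σ x
  fun f ts ⟨ σ ⟩ₜ = fun f (ts ⟨ σ ⟩ₜₛ)

  _⟨_⟩ₜₛ : List Term → Subst → List Term
  []       ⟨ σ ⟩ₜₛ = []
  (t ∷ ts) ⟨ σ ⟩ₜₛ = t ⟨ σ ⟩ₜ ∷ ts ⟨ σ ⟩ₜₛ

_⟨_⟩ : Fml → Subst → Fml
atom p ts ⟨ σ ⟩ = atom p (ts ⟨ σ ⟩ₜₛ)
(¬ᶠ A)    ⟨ σ ⟩ = ¬ᶠ (A ⟨ σ ⟩)
(A ∧ᶠ B)  ⟨ σ ⟩ = (A ⟨ σ ⟩) ∧ᶠ (B ⟨ σ ⟩)
(A ∨ᶠ B)  ⟨ σ ⟩ = (A ⟨ σ ⟩) ∨ᶠ (B ⟨ σ ⟩)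

_⟨_⟩* : List Fml → Subst → List Fml
Γ ⟨ σ ⟩* = map (_⟨ σ ⟩) Γ

mutual
  varsₜ : Term → List ℕ
  varsₜ (var x)    = [ x ]
  varsₜ (fun f ts) = varsₜₛ ts

  varsₜₛ : List Term → List ℕ
  varsₜₛ []       = []
  varsₜₛ (t ∷ ts) = varsₜ t ++ varsₜₛ ts

vars : Fml → List ℕ
vars (atom p ts) = varsₜₛ ts
vars (¬ᶠ A)      = vars A
vars (A ∧ᶠ B)    = vars A ++ vars B
vars (A ∨ᶠ B)    = vars A ++ vars B

vars* : List Fml → List ℕ
vars* []       = []
vars* (A ∷ Γ)  = vars A ++ vars* Γ

Unifier : Subst → List Fml → Set
Unifier σ Fs = ∀ {A B} → A ∈ Fs → B ∈ Fs → A ⟨ σ ⟩ ≡ B ⟨ σ ⟩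

MGU : Subst → List Fml → Set
MGU σ Fs = Unifier σ Fs ×
           (∀ τ → Unifier τ Fs → Σ Subst λ ρ → ∀ x → τ x ≡ (σ x) ⟨ ρ ⟩ₜ)

Renaming : Subst → Set
Renaming θ = Σ (ℕ → ℕ) λ ρ → Injective _≡_ _≡_ ρ × (∀ x → θ x ≡ var (ρ x))

-- Sequents Γ ⊢ Δ; lists are read as multisets (see the `perm` rule of
-- derivations below).

record Seq : Set where
  constructor _⊢_
  field
    ant : List Fml
    suc : List Fml

infix 3 _⊢_

record Structure : Set₁ where
  field
    D     : Set
    d₀    : D
    funI  : ℕ → List D → D
    relI  : ℕ → List D → Bool

module _ (𝔐 : Structure) where
  open Structure 𝔐

  mutual
    evalₜ : (ℕ → D) → Term → D
    evalₜ a (var x)    = a x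
    evalₜ a (fun f ts) = funI f (evalₜₛ a ts)

    evalₜₛ : (ℕ → D) → List Term → List D
    evalₜₛ a []       = []
    evalₜₛ a (t ∷ ts) = evalₜ a t ∷ evalₜₛ a ts

  eval : (ℕ → D) → Fml → Bool
  eval a (atom p ts) = relI p (evalₜₛ a ts)
  eval a (¬ᶠ A)      = not (eval a A)
  eval a (A ∧ᶠ B)    = eval a A ∧ eval a B
  eval a (A ∨ᶠ B)    = eval a A ∨ eval a B

  ModelOf : Fml → Set
  ModelOf F = ∀ (a : ℕ → D) → eval a F ≡ true

  ModelOfSeq : Seq → Set
  ModelOfSeq (Γ ⊢ Δ) =
    ∀ (a : ℕ → D) → All (λ A → eval a A ≡ true) Γ → Any (λ B → eval a B ≡ true) Δ

Satisfiable : Fml → Set₁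
Satisfiable F = Σ Structure λ 𝔐 → ModelOf 𝔐 F

data Rule : List Seq → Seq → Set where
  ∧R₁ : ∀ {Γ Δ A B} → Rule [ Γ ⊢ (A ∧ᶠ B) ∷ Δ ] (Γ ⊢ A ∷ Δ)
  ∧R₂ : ∀ {Γ Δ A B} → Rule [ Γ ⊢ (A ∧ᶠ B) ∷ Δ ] (Γ ⊢ B ∷ Δ)
  ∧L  : ∀ {Γ Δ A B} → Rule [ (A ∧ᶠ B) ∷ Γ ⊢ Δ ] (A ∷ B ∷ Γ ⊢ Δ)
  ∨R  : ∀ {Γ Δ A B} → Rule [ Γ ⊢ (A ∨ᶠ B) ∷ Δ ] (Γ ⊢ A ∷ B ∷ Δ)
  ∨L₁ : ∀ {Γ Δ A B} → Rule [ (A ∨ᶠ B) ∷ Γ ⊢ Δ ] (A ∷ Γ ⊢ Δ)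
  ∨L₂ : ∀ {Γ Δ A B} → Rule [ (A ∨ᶠ B) ∷ Γ ⊢ Δ ] (B ∷ Γ ⊢ Δ)
  ¬R  : ∀ {Γ Δ A} → Rule [ Γ ⊢ (¬ᶠ A) ∷ Δ ] (A ∷ Γ ⊢ Δ)
  ¬L  : ∀ {Γ Δ A} → Rule [ (¬ᶠ A) ∷ Γ ⊢ Δ ] (Γ ⊢ A ∷ Δ)
  -- resolution, with k ≥ 1 resolved formulas A₁..A_k = A ∷ As and
  -- l ≥ 1 resolved formulas B₁..B_l = B ∷ Bs
  res : ∀ {Γ Δ Π Λ A B As Bs θ} →
        (∀ {x} → x ∈ vars* (A ∷ As) → x ∉ vars* (B ∷ Bs)) →
        MGU θ ((A ∷ As) ++ (B ∷ Bs)) →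
        Rule ((Γ ⊢ Δ ++ (A ∷ As)) ∷ ((B ∷ Bs) ++ Π ⊢ Λ) ∷ [])
             ((Γ ++ Π) ⟨ θ ⟩* ⊢ (Δ ++ Λ) ⟨ θ ⟩*)

data Der (Ax : Seq → Set) : Seq → Set where
  axiom : ∀ {s} → Ax s → Der Ax s
  rule  : ∀ {ps c} → Rule ps c → All (Der Ax) ps → Der Ax c
  perm  : ∀ {Γ Γ′ Δ Δ′} → Γ ↭ Γ′ → Δ ↭ Δ′ → Der Ax (Γ ⊢ Δ) → Der Ax (Γ′ ⊢ Δ′)

RenamedAxioms : Fml → Seq → Set
RenamedAxioms F s = Σ Subst λ θ → Renaming θ × s ≡ ([] ⊢ [ F ⟨ θ ⟩ ])

module Submission where

-- Soundness is rule by rule: a model of the premises of a resolution step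
-- sees the unified formulas A⟨θ⟩ᵢ, B⟨θ⟩ⱼ as one formula, so it cuts them.
--
-- Completeness follows the semantic-tree argument with lifting.
--  * Unification: a solvable system of term equations has a most general
--    solution (Robinson's algorithm, run against the known solution);
--    formulas are coded as terms, so unifiable formulas have an mgu.
--  * Renaming apart: derivations from axioms closed under the shift
--    x ↦ x + N can be shifted, transporting mgus along the shift.
--  * Lifting: the ground sequents that are instances (up to reordering) of
--    derivable sequents are closed under the inverted one-premise rules and
--    under resolution on a ground formula.
--  * Semantic tree: atoms are enumerated through an injective coding into ℕ.
--    A node at depth n is closed when its valuation falsifies such an
--    instance using the first n atoms only.  Decomposing by the one-premise
--    rules leaves only atoms, so two closed children make their parent
--    closed by resolution on atom n.  With excluded middle we follow a branch
--    of non-closed nodes; unless ⊢ is derivable (a closed root) its limit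
--    valuation gives a Herbrand model of ∀F, as every instance of ⊢ F is an
--    instance of an axiom.

open import Defs
open import Level using (0ℓ)
open import Axiom.ExcludedMiddle using (ExcludedMiddle)
open import Data.Nat using (ℕ; zero; suc; _+_; _∸_; _<_; _≤_; z≤n; s≤s; _≟_; _<?_)
open import Data.Nat.Properties
  using (≤-refl; ≤-trans; ≤-pred; <⇒≤; n≤1+n; 1+n≰n; m≤m+n; m≤n+m; +-suc;
         m∸n+n≡m; m+n∸n≡m; ≮⇒≥; m+n≮n; +-cancelʳ-≡; <⇒≱; +-mono-≤; +-monoʳ-≤;
         +-comm; <-cmp; <-irrefl; +-cancelˡ-≡; suc-injective; ≤∧≢⇒<; module ≤-Reasoning)
open import Data.Nat.Tactic.RingSolver using (solve-∀)
open import Data.Bool using (Bool; true; false; not; _∧_; _∨_)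
open import Data.Bool.Properties
  using (∧-conicalˡ; ∧-conicalʳ; ∨-conicalˡ; ∨-conicalʳ; ∨-zeroʳ; not-¬; not-injective)
open import Data.List using (List; []; _∷_; _++_; map; length; filter)
open import Data.List.Properties using (map-++; filter-notAll; ∷-injective; ++-identityʳ)
open import Data.List.Extrema.Nat using (max; xs≤max)
open import Data.List.Relation.Unary.All as All using (All; []; _∷_)
open import Data.List.Relation.Unary.All.Properties using (map⁻)
  renaming (++⁺ to All-++⁺; ++⁻ˡ to All-++⁻ˡ; ++⁻ʳ to All-++⁻ʳ)
open import Data.List.Relation.Unary.Any as Any using (Any; here; there)
open import Data.List.Relation.Unary.Any.Properties using (++⁺ˡ; ++⁺ʳ; ++⁻)
  renaming (map⁺ to Any-map⁺)
open import Data.List.Membership.Propositional using (_∈_; _∉_; find)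
open import Data.List.Membership.Propositional.Properties using (∈-filter⁺; ∈-map⁺; ∈-map⁻)
open import Data.List.Membership.DecPropositional _≟_ using (_∈?_)
open import Data.List.Relation.Binary.Permutation.Propositional
  using (_↭_; ↭-refl; ↭-sym; ↭-trans; ↭-reflexive; prep)
open import Data.List.Relation.Binary.Permutation.Propositional.Properties
  using (↭-map-inv; ↭-empty-inv)
  renaming (shift to ↭-shift; map⁺ to ↭-map⁺; ++⁺ to ↭-++⁺; ++-comm to ↭-++-comm)
open import Data.Product using (Σ; _×_; _,_; proj₁; proj₂; map₂)
open import Data.Sum using (_⊎_; inj₁; inj₂)
open import Data.Empty using (⊥-elim)
open import Relation.Binary.PropositionalEquality
  using (_≡_; refl; sym; trans; cong; cong₂; subst; module ≡-Reasoning)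
open import Relation.Nullary using (¬_; Dec; yes; no; ¬?)
open import Relation.Unary using (_⊆_)
open import Relation.Binary.Definitions using (tri<; tri≈; tri>)

_∘ₛ_ : Subst → Subst → Subst
(σ ∘ₛ τ) x = σ x ⟨ τ ⟩ₜ

_≗_on_ : Subst → Subst → List ℕ → Set
σ ≗ τ on xs = All (λ x → σ x ≡ τ x) xs

mutual
  agreeₜ : ∀ {σ τ} t → σ ≗ τ on varsₜ t → t ⟨ σ ⟩ₜ ≡ t ⟨ τ ⟩ₜ
  agreeₜ (var x)    (p ∷ []) = p
  agreeₜ (fun f ts) ps       = cong (fun f) (agreeₜₛ ts ps)

  agreeₜₛ : ∀ {σ τ} ts → σ ≗ τ on varsₜₛ ts → ts ⟨ σ ⟩ₜₛ ≡ ts ⟨ τ ⟩ₜₛ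
  agreeₜₛ []       ps = refl
  agreeₜₛ (t ∷ ts) ps =
    cong₂ _∷_ (agreeₜ t (All-++⁻ˡ (varsₜ t) ps)) (agreeₜₛ ts (All-++⁻ʳ (varsₜ t) ps))

agree : ∀ {σ τ} A → σ ≗ τ on vars A → A ⟨ σ ⟩ ≡ A ⟨ τ ⟩
agree (atom p ts) ps = cong (atom p) (agreeₜₛ ts ps)
agree (¬ᶠ A)      ps = cong ¬ᶠ_ (agree A ps)
agree (A ∧ᶠ B)    ps = cong₂ _∧ᶠ_ (agree A (All-++⁻ˡ (vars A) ps)) (agree B (All-++⁻ʳ (vars A) ps))
agree (A ∨ᶠ B)    ps = cong₂ _∨ᶠ_ (agree A (All-++⁻ˡ (vars A) ps)) (agree B (All-++⁻ʳ (vars A) ps))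

agree* : ∀ {σ τ} Γ → σ ≗ τ on vars* Γ → Γ ⟨ σ ⟩* ≡ Γ ⟨ τ ⟩*
agree* []      ps = refl
agree* (A ∷ Γ) ps = cong₂ _∷_ (agree A (All-++⁻ˡ (vars A) ps)) (agree* Γ (All-++⁻ʳ (vars A) ps))

mutual
  compₜ : ∀ {σ τ} t → t ⟨ σ ⟩ₜ ⟨ τ ⟩ₜ ≡ t ⟨ σ ∘ₛ τ ⟩ₜ
  compₜ (var x)    = refl
  compₜ (fun f ts) = cong (fun f) (compₜₛ ts)

  compₜₛ : ∀ {σ τ} ts → ts ⟨ σ ⟩ₜₛ ⟨ τ ⟩ₜₛ ≡ ts ⟨ σ ∘ₛ τ ⟩ₜₛ
  compₜₛ []       = refl
  compₜₛ (t ∷ ts) = cong₂ _∷_ (compₜ t) (compₜₛ ts)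

comp : ∀ {σ τ} A → A ⟨ σ ⟩ ⟨ τ ⟩ ≡ A ⟨ σ ∘ₛ τ ⟩
comp (atom p ts) = cong (atom p) (compₜₛ ts)
comp (¬ᶠ A)      = cong ¬ᶠ_ (comp A)
comp (A ∧ᶠ B)    = cong₂ _∧ᶠ_ (comp A) (comp B)
comp (A ∨ᶠ B)    = cong₂ _∨ᶠ_ (comp A) (comp B)

comp* : ∀ {σ τ} Γ → Γ ⟨ σ ⟩* ⟨ τ ⟩* ≡ Γ ⟨ σ ∘ₛ τ ⟩*
comp* []      = refl
comp* (A ∷ Γ) = cong₂ _∷_ (comp A) (comp* Γ)

mutual
  idₜ : ∀ t → t ⟨ var ⟩ₜ ≡ t
  idₜ (var x)    = refl
  idₜ (fun f ts) = cong (fun f) (idₜₛ ts)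

  idₜₛ : ∀ ts → ts ⟨ var ⟩ₜₛ ≡ ts
  idₜₛ []       = refl
  idₜₛ (t ∷ ts) = cong₂ _∷_ (idₜ t) (idₜₛ ts)

mutual
  varsSubₜ : ∀ {P : ℕ → Set} σ t → All (λ y → All P (varsₜ (σ y))) (varsₜ t) →
             All P (varsₜ (t ⟨ σ ⟩ₜ))
  varsSubₜ σ (var x)    (p ∷ []) = p
  varsSubₜ σ (fun f ts) ps       = varsSubₜₛ σ ts ps

  varsSubₜₛ : ∀ {P : ℕ → Set} σ ts → All (λ y → All P (varsₜ (σ y))) (varsₜₛ ts) →
              All P (varsₜₛ (ts ⟨ σ ⟩ₜₛ))
  varsSubₜₛ σ []       ps = []
  varsSubₜₛ σ (t ∷ ts) ps =
    All-++⁺ (varsSubₜ σ t (All-++⁻ˡ (varsₜ t) ps)) (varsSubₜₛ σ ts (All-++⁻ʳ (varsₜ t) ps))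

varsSub : ∀ {P : ℕ → Set} σ A → All (λ y → All P (varsₜ (σ y))) (vars A) → All P (vars (A ⟨ σ ⟩))
varsSub σ (atom p ts) ps = varsSubₜₛ σ ts ps
varsSub σ (¬ᶠ A)      ps = varsSub σ A ps
varsSub σ (A ∧ᶠ B)    ps = All-++⁺ (varsSub σ A (All-++⁻ˡ (vars A) ps)) (varsSub σ B (All-++⁻ʳ (vars A) ps))
varsSub σ (A ∨ᶠ B)    ps = All-++⁺ (varsSub σ A (All-++⁻ˡ (vars A) ps)) (varsSub σ B (All-++⁻ʳ (vars A) ps))

varsSub* : ∀ {P : ℕ → Set} σ Γ → All (λ y → All P (varsₜ (σ y))) (vars* Γ) →
           All P (vars* (Γ ⟨ σ ⟩*))
varsSub* σ []      ps = []
varsSub* σ (A ∷ Γ) ps = All-++⁺ (varsSub σ A (All-++⁻ˡ (vars A) ps)) (varsSub* σ Γ (All-++⁻ʳ (vars A) ps))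

∨-true-split : ∀ a {b} → a ∨ b ≡ true → a ≡ true ⊎ b ≡ true
∨-true-split true  _ = inj₁ refl
∨-true-split false p = inj₂ p

∧-false-split : ∀ a {b} → a ∧ b ≡ false → a ≡ false ⊎ b ≡ false
∧-false-split false _ = inj₁ refl
∧-false-split true  p = inj₂ p

module _ (𝔐 : Structure) where
  open Structure 𝔐

  _⊙_ : (ℕ → D) → Subst → ℕ → D
  (a ⊙ σ) x = evalₜ 𝔐 a (σ x)

  True : (ℕ → D) → Fml → Set
  True a A = eval 𝔐 a A ≡ true

  mutual
    evalₜ-sub : ∀ a σ t → evalₜ 𝔐 a (t ⟨ σ ⟩ₜ) ≡ evalₜ 𝔐 (a ⊙ σ) t
    evalₜ-sub a σ (var x)    = refl
    evalₜ-sub a σ (fun f ts) = cong (funI f) (evalₜₛ-sub a σ ts)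

    evalₜₛ-sub : ∀ a σ ts → evalₜₛ 𝔐 a (ts ⟨ σ ⟩ₜₛ) ≡ evalₜₛ 𝔐 (a ⊙ σ) ts
    evalₜₛ-sub a σ []       = refl
    evalₜₛ-sub a σ (t ∷ ts) = cong₂ _∷_ (evalₜ-sub a σ t) (evalₜₛ-sub a σ ts)

  eval-sub : ∀ a σ A → eval 𝔐 a (A ⟨ σ ⟩) ≡ eval 𝔐 (a ⊙ σ) A
  eval-sub a σ (atom p ts) = cong (relI p) (evalₜₛ-sub a σ ts)
  eval-sub a σ (¬ᶠ A)      = cong not (eval-sub a σ A)
  eval-sub a σ (A ∧ᶠ B)    = cong₂ _∧_ (eval-sub a σ A) (eval-sub a σ B)
  eval-sub a σ (A ∨ᶠ B)    = cong₂ _∨_ (eval-sub a σ A) (eval-sub a σ B)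

  all-true-sub : ∀ a σ Γ → All (True a) (Γ ⟨ σ ⟩*) → All (True (a ⊙ σ)) Γ
  all-true-sub a σ Γ h = All.map (λ {A} p → trans (sym (eval-sub a σ A)) p) (map⁻ h)

  some-true-sub : ∀ a σ Δ → Any (True (a ⊙ σ)) Δ → Any (True a) (Δ ⟨ σ ⟩*)
  some-true-sub a σ Δ h = Any-map⁺ (Any.map (λ {A} p → trans (eval-sub a σ A) p) h)

  unified-same-value : ∀ {θ Fs} a → Unifier θ Fs → ∀ {X Y} → X ∈ Fs → Y ∈ Fs →
                       eval 𝔐 (a ⊙ θ) X ≡ eval 𝔐 (a ⊙ θ) Y
  unified-same-value {θ} a unifies {X} {Y} X∈ Y∈ =
    trans (sym (eval-sub a θ X)) (trans (cong (eval 𝔐 a) (unifies X∈ Y∈)) (eval-sub a θ Y))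

  sound : ∀ {ps c} → Rule ps c → All (ModelOfSeq 𝔐) ps → ModelOfSeq 𝔐 c
  sound ∧R₁ (m ∷ []) a h with m a h
  ... | here p  = here (∧-conicalˡ _ _ p)
  ... | there q = there q
  sound ∧R₂ (m ∷ []) a h with m a h
  ... | here p  = here (∧-conicalʳ _ _ p)
  ... | there q = there q
  sound ∧L (m ∷ []) a (pA ∷ pB ∷ ps) = m a (cong₂ _∧_ pA pB ∷ ps)
  sound (∨R {A = A}) (m ∷ []) a h with m a h
  ... | there q = there (there q)
  ... | here p with ∨-true-split (eval 𝔐 a A) p
  ...   | inj₁ pA = here pA
  ...   | inj₂ pB = there (here pB)
  sound ∨L₁ (m ∷ []) a (p ∷ ps) = m a (cong (_∨ _) p ∷ ps)
  sound (∨L₂ {A = A}) (m ∷ []) a (p ∷ ps) = m a (trans (cong (eval 𝔐 a A ∨_) p) (∨-zeroʳ _) ∷ ps)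
  sound ¬R (m ∷ []) a (p ∷ ps) with m a ps
  ... | there q = q
  ... | here q  = ⊥-elim (not-¬ (sym p) (sym q))
  sound (¬L {A = A}) (m ∷ []) a ps with eval 𝔐 a A in eq
  ... | true  = here eq
  ... | false = there (m a (cong not eq ∷ ps))
  sound (res {Γ} {Δ} {Π} {Λ} {A} {B} {As} {Bs} {θ} _ (unifies , _)) (m₁ ∷ m₂ ∷ []) a h =
    some-true-sub a θ (Δ ++ Λ) (resolve (++⁻ Δ (m₁ (a ⊙ θ) (All-++⁻ˡ Γ hyps))))
    where
    hyps : All (True (a ⊙ θ)) (Γ ++ Π)
    hyps = all-true-sub a θ (Γ ++ Π) h
    allB : Any (True (a ⊙ θ)) (A ∷ As) → All (True (a ⊙ θ)) (B ∷ Bs)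
    allB someA with find someA
    ... | X , X∈ , pX =
      All.tabulate λ Y∈ → trans (unified-same-value a unifies (++⁺ʳ (A ∷ As) Y∈) (++⁺ˡ X∈)) pX
    resolve : Any (True (a ⊙ θ)) Δ ⊎ Any (True (a ⊙ θ)) (A ∷ As) → Any (True (a ⊙ θ)) (Δ ++ Λ)
    resolve (inj₁ inΔ)  = ++⁺ˡ inΔ
    resolve (inj₂ someA) = ++⁺ʳ Δ (m₂ (a ⊙ θ) (All-++⁺ (allB someA) (All-++⁻ʳ Γ hyps)))

Eqn : Set
Eqn = Term × Term

_⟨_⟩ₑ : List Eqn → Subst → List Eqn
[]            ⟨ σ ⟩ₑ = []
((s , t) ∷ E) ⟨ σ ⟩ₑ = (s ⟨ σ ⟩ₜ , t ⟨ σ ⟩ₜ) ∷ E ⟨ σ ⟩ₑ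

_solves_ : Subst → Eqn → Set
σ solves (s , t) = s ⟨ σ ⟩ₜ ≡ t ⟨ σ ⟩ₜ

Solves : Subst → List Eqn → Set
Solves σ E = All (σ solves_) E

_≼_ : Subst → Subst → Set
θ ≼ τ = Σ Subst λ ρ → ∀ x → τ x ≡ θ x ⟨ ρ ⟩ₜ

MostGeneral : Subst → List Eqn → Set
MostGeneral θ E = Solves θ E × (∀ τ → Solves τ E → θ ≼ τ)

-- systems with the same solutions have the same most general solutions;
-- this justifies swapping, dropping trivial and decomposing equations
mostGeneral-resp : ∀ {θ E E′} → (∀ {σ} → Solves σ E → Solves σ E′) →
                   (∀ {σ} → Solves σ E′ → Solves σ E) → MostGeneral θ E → MostGeneral θ E′
mostGeneral-resp to from (solved , general) = to solved , λ τ sol → general τ (from sol)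

swap-solves : ∀ {σ s t E} → Solves σ ((s , t) ∷ E) → Solves σ ((t , s) ∷ E)
swap-solves (p ∷ ps) = sym p ∷ ps

drop-solves : ∀ {σ t E} → Solves σ E → Solves σ ((t , t) ∷ E)
drop-solves ps = refl ∷ ps

fun-∷-injective : ∀ {f g t w ts ws} → fun f (t ∷ ts) ≡ fun g (w ∷ ws) → t ≡ w × fun f ts ≡ fun g ws
fun-∷-injective refl = refl , refl

fun-∷-cong : ∀ {f g t w ts ws} → t ≡ w → fun f ts ≡ fun g ws → fun f (t ∷ ts) ≡ fun g (w ∷ ws)
fun-∷-cong refl refl = refl

decompose-solves : ∀ {σ f g t w ts ws E} → Solves σ ((fun f (t ∷ ts) , fun g (w ∷ ws)) ∷ E) →
                   Solves σ ((t , w) ∷ (fun f ts , fun g ws) ∷ E)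
decompose-solves (p ∷ ps) = proj₁ (fun-∷-injective p) ∷ proj₂ (fun-∷-injective p) ∷ ps

compose-solves : ∀ {σ f g t w ts ws E} → Solves σ ((t , w) ∷ (fun f ts , fun g ws) ∷ E) →
                 Solves σ ((fun f (t ∷ ts) , fun g (w ∷ ws)) ∷ E)
compose-solves (p ∷ q ∷ ps) = fun-∷-cong p q ∷ ps

_↦_ : ℕ → Term → Subst
(x ↦ t) y with y ≟ x
... | yes _ = t
... | no  _ = var y

↦-self : ∀ x t → (x ↦ t) x ≡ t
↦-self x t with x ≟ x
... | yes _  = refl
... | no x≢x = ⊥-elim (x≢x refl)

↦-fresh : ∀ x t → x ∉ varsₜ t → t ⟨ x ↦ t ⟩ₜ ≡ t
↦-fresh x t x∉t = trans (agreeₜ t (All.tabulate untouched)) (idₜ t)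
  where
  untouched : ∀ {y} → y ∈ varsₜ t → (x ↦ t) y ≡ var y
  untouched {y} y∈t with y ≟ x
  ... | yes refl = ⊥-elim (x∉t y∈t)
  ... | no  _    = refl

↦-absorbed : ∀ x t τ → τ x ≡ t ⟨ τ ⟩ₜ → ∀ y → ((x ↦ t) ∘ₛ τ) y ≡ τ y
↦-absorbed x t τ p y with y ≟ x
... | yes refl = sym p
... | no  _    = refl

solves-sub : ∀ {σ τ} E → (∀ y → (σ ∘ₛ τ) y ≡ τ y) → Solves τ E → Solves τ (E ⟨ σ ⟩ₑ)
solves-sub []            fix []       = []
solves-sub {σ} {τ} ((s , t) ∷ E) fix (p ∷ ps) =
  trans (fixed s) (trans p (sym (fixed t))) ∷ solves-sub E fix ps
  where
  fixed : ∀ u → u ⟨ σ ⟩ₜ ⟨ τ ⟩ₜ ≡ u ⟨ τ ⟩ₜ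
  fixed u = trans (compₜ u) (agreeₜ u (All.universal fix _))

solves-comp : ∀ {σ θ} E → Solves θ (E ⟨ σ ⟩ₑ) → Solves (σ ∘ₛ θ) E
solves-comp []            []       = []
solves-comp ((s , t) ∷ E) (p ∷ ps) = trans (sym (compₜ s)) (trans p (compₜ t)) ∷ solves-comp E ps

eliminate : ∀ {θ} x t E → x ∉ varsₜ t → MostGeneral θ (E ⟨ x ↦ t ⟩ₑ) →
            MostGeneral ((x ↦ t) ∘ₛ θ) ((var x , t) ∷ E)
eliminate {θ} x t E x∉t (solved , general) = (head ∷ solves-comp E solved) , more-general
  where
  open ≡-Reasoning
  head : ((x ↦ t) ∘ₛ θ) x ≡ t ⟨ (x ↦ t) ∘ₛ θ ⟩ₜ
  head = begin
    (x ↦ t) x ⟨ θ ⟩ₜ         ≡⟨ cong (_⟨ θ ⟩ₜ) (↦-self x t) ⟩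
    t                ⟨ θ ⟩ₜ  ≡⟨ cong (_⟨ θ ⟩ₜ) (sym (↦-fresh x t x∉t)) ⟩
    t ⟨ x ↦ t ⟩ₜ     ⟨ θ ⟩ₜ  ≡⟨ compₜ t ⟩
    t ⟨ (x ↦ t) ∘ₛ θ ⟩ₜ      ∎
  more-general : ∀ τ → Solves τ ((var x , t) ∷ E) → ((x ↦ t) ∘ₛ θ) ≼ τ
  more-general τ (p ∷ ps) with general τ (solves-sub E (↦-absorbed x t τ p) ps)
  ... | ρ , τ≡θρ = ρ , λ y → begin
    τ y                             ≡⟨ sym (↦-absorbed x t τ p y) ⟩
    (x ↦ t) y ⟨ τ ⟩ₜ                ≡⟨ agreeₜ ((x ↦ t) y) (All.universal τ≡θρ _) ⟩
    (x ↦ t) y ⟨ θ ∘ₛ ρ ⟩ₜ           ≡⟨ sym (compₜ ((x ↦ t) y)) ⟩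
    (x ↦ t) y ⟨ θ ⟩ₜ ⟨ ρ ⟩ₜ         ∎

-- sizes: every step of the unification algorithm below that keeps the
-- variables in scope decreases the total size of the system
mutual
  sizeₜ : Term → ℕ
  sizeₜ (var x)    = 1
  sizeₜ (fun f ts) = suc (sizeₜₛ ts)

  sizeₜₛ : List Term → ℕ
  sizeₜₛ []       = 0
  sizeₜₛ (t ∷ ts) = suc (sizeₜ t + sizeₜₛ ts)

size : List Eqn → ℕ
size []            = 0
size ((s , t) ∷ E) = sizeₜ s + (sizeₜ t + size E)

decompose-size : ∀ a b c d e →
  2 + (a + (c + (suc b + (suc d + e)))) ≡ suc (suc (a + b)) + (suc (suc (c + d)) + e)
decompose-size = solve-∀

mutual
  occurs-≤ : ∀ τ x t → x ∈ varsₜ t → sizeₜ (τ x) ≤ sizeₜ (t ⟨ τ ⟩ₜ)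
  occurs-≤ τ x (var y)    (here refl) = ≤-refl
  occurs-≤ τ x (fun f ts) x∈          = ≤-trans (<⇒≤ (occurs-< τ x ts x∈)) (n≤1+n _)

  occurs-< : ∀ τ x ts → x ∈ varsₜₛ ts → sizeₜ (τ x) < sizeₜₛ (ts ⟨ τ ⟩ₜₛ)
  occurs-< τ x (t ∷ ts) x∈ with ++⁻ (varsₜ t) x∈
  ... | inj₁ x∈t  = s≤s (≤-trans (occurs-≤ τ x t x∈t) (m≤m+n _ _))
  ... | inj₂ x∈ts = s≤s (≤-trans (<⇒≤ (occurs-< τ x ts x∈ts)) (m≤n+m _ _))

occurs-check : ∀ τ x f ts → x ∈ varsₜₛ ts → ¬ τ x ≡ fun f ts ⟨ τ ⟩ₜ
occurs-check τ x f ts x∈ p =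
  1+n≰n (≤-trans (n≤1+n _) (subst (_< sizeₜₛ (ts ⟨ τ ⟩ₜₛ)) (cong sizeₜ p) (occurs-< τ x ts x∈)))

VarsIn : List ℕ → Term → Set
VarsIn S t = All (_∈ S) (varsₜ t)

InScope : List ℕ → List Eqn → Set
InScope S E = All (λ e → VarsIn S (proj₁ e) × VarsIn S (proj₂ e)) E

inScope-sub : ∀ {S S′} σ E → (∀ {y} → y ∈ S → VarsIn S′ (σ y)) → InScope S E → InScope S′ (E ⟨ σ ⟩ₑ)
inScope-sub σ []            f []              = []
inScope-sub σ ((s , t) ∷ E) f ((ss , st) ∷ sc) =
  (varsSubₜ σ s (All.map f ss) , varsSubₜ σ t (All.map f st)) ∷ inScope-sub σ E f sc

module _ (S : List ℕ) (x : ℕ) where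
  without : List ℕ
  without = filter (λ z → ¬? (z ≟ x)) S

  without-shorter : x ∈ S → length without < length S
  without-shorter x∈S = filter-notAll (λ z → ¬? (z ≟ x)) S (Any.map (λ x≡z z≢x → z≢x (sym x≡z)) x∈S)

  ↦-inScope : ∀ {t} → x ∉ varsₜ t → VarsIn S t → ∀ {y} → y ∈ S → VarsIn without ((x ↦ t) y)
  ↦-inScope {t} x∉t st {y} y∈S with y ≟ x
  ... | yes refl = All.tabulate λ {z} z∈t →
                     ∈-filter⁺ (λ z → ¬? (z ≟ x)) (All.lookup st z∈t) λ { refl → x∉t z∈t }
  ... | no  y≢x  = ∈-filter⁺ (λ z → ¬? (z ≟ x)) y∈S y≢x ∷ []

-- Robinson's algorithm, run against a known solution τ (which rules out
-- clashes and occurs-check failures); k bounds the number of variables in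
-- scope, and m the size of the system
mutual
  unify : ∀ k m S E → length S ≤ k → size E ≤ m → InScope S E →
          ∀ τ → Solves τ E → Σ Subst λ θ → MostGeneral θ E
  unify k m       S [] _ _ _ _ _ = var , [] , λ τ _ → τ , λ x → refl
  unify k zero    S ((var _ , _) ∷ _)   _ () _ _ _
  unify k zero    S ((fun _ _ , _) ∷ _) _ () _ _ _
  unify k (suc m) S ((var x , t) ∷ E) hk (s≤s hm) ((sx ∷ [] , st) ∷ sc) τ (p ∷ ps) =
    unifyVar k m S x t E hk hm sx st sc τ p ps
  unify k (suc m) S ((fun f ts , var x) ∷ E) hk hm ((sf , sx ∷ []) ∷ sc) τ (p ∷ ps) =
    map₂ (mostGeneral-resp swap-solves swap-solves)
         (unifyVar k m S x (fun f ts) E hk hm′ sx sf sc τ (sym p) ps)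
    where
    hm′ : sizeₜ (fun f ts) + size E ≤ m
    hm′ = ≤-pred (subst (_≤ suc m) (+-suc (sizeₜ (fun f ts)) (size E)) hm)
  unify k (suc m) S ((fun f [] , fun g []) ∷ E) hk (s≤s hm) (_ ∷ sc) τ (refl ∷ ps) =
    map₂ (mostGeneral-resp drop-solves All.tail) (unify k m S E hk (≤-trans (n≤1+n _) hm) sc τ ps)
  unify k (suc m) S ((fun f [] , fun g (_ ∷ _)) ∷ E) _ _ _ τ (() ∷ _)
  unify k (suc m) S ((fun f (_ ∷ _) , fun g []) ∷ E) _ _ _ τ (() ∷ _)
  unify k (suc m) S ((fun f (t ∷ ts) , fun g (w ∷ ws)) ∷ E) hk hm ((sf , sg) ∷ sc) τ sol =
    map₂ (mostGeneral-resp compose-solves decompose-solves)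
         (unify k m S ((t , w) ∷ (fun f ts , fun g ws) ∷ E) hk hm′ sc′ τ (decompose-solves sol))
    where
    hm′ : size ((t , w) ∷ (fun f ts , fun g ws) ∷ E) ≤ m
    hm′ = ≤-trans (n≤1+n _) (≤-pred (subst (_≤ suc m)
            (sym (decompose-size (sizeₜ t) (sizeₜₛ ts) (sizeₜ w) (sizeₜₛ ws) (size E))) hm))
    sc′ : InScope S ((t , w) ∷ (fun f ts , fun g ws) ∷ E)
    sc′ = (All-++⁻ˡ (varsₜ t) sf , All-++⁻ˡ (varsₜ w) sg)
        ∷ (All-++⁻ʳ (varsₜ t) sf , All-++⁻ʳ (varsₜ w) sg) ∷ sc

  unifyVar : ∀ k m S x t E → length S ≤ k → sizeₜ t + size E ≤ m → x ∈ S → VarsIn S t →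
             InScope S E → ∀ τ → τ x ≡ t ⟨ τ ⟩ₜ → Solves τ E → Σ Subst λ θ → MostGeneral θ ((var x , t) ∷ E)
  unifyVar k m S x t E hk hm sx st sc τ p ps with x ∈? varsₜ t
  ... | yes x∈t = unifyOccurring k m S x t E hk hm sc τ p ps x∈t
  ... | no  x∉t = unifyEliminate k S x t E hk sx st sc τ p ps x∉t

  -- x occurs in t: by the occurs check t is x itself, and the equation is trivial
  unifyOccurring : ∀ k m S x t E → length S ≤ k → sizeₜ t + size E ≤ m → InScope S E →
                   ∀ τ → τ x ≡ t ⟨ τ ⟩ₜ → Solves τ E → x ∈ varsₜ t →
                   Σ Subst λ θ → MostGeneral θ ((var x , t) ∷ E)
  unifyOccurring k m S x (var .x) E hk hm sc τ p ps (here refl) =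
    map₂ (mostGeneral-resp drop-solves All.tail) (unify k m S E hk (≤-trans (n≤1+n _) hm) sc τ ps)
  unifyOccurring k m S x (fun f ts) E hk hm sc τ p ps x∈ = ⊥-elim (occurs-check τ x f ts x∈ p)

  -- x does not occur in t: eliminate x, which removes it from the scope
  unifyEliminate : ∀ k S x t E → length S ≤ k → x ∈ S → VarsIn S t → InScope S E →
                   ∀ τ → τ x ≡ t ⟨ τ ⟩ₜ → Solves τ E → x ∉ varsₜ t →
                   Σ Subst λ θ → MostGeneral θ ((var x , t) ∷ E)
  unifyEliminate zero    (_ ∷ _) x t E () sx st sc τ p ps x∉t
  unifyEliminate (suc k) S x t E hk sx st sc τ p ps x∉t =
    Data.Product.map ((x ↦ t) ∘ₛ_) (eliminate x t E x∉t)
      (unify k (size (E ⟨ x ↦ t ⟩ₑ)) (without S x) (E ⟨ x ↦ t ⟩ₑ)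
             (≤-pred (≤-trans (without-shorter S x sx) hk)) ≤-refl
             (inScope-sub (x ↦ t) E (↦-inScope S x x∉t st) sc)
             τ (solves-sub E (↦-absorbed x t τ p) ps))

-- Formulas are terms over an extended signature (connectives become the
-- function symbols 0–3); the coding commutes with substitution and has a
-- left inverse, so unifying formulas is unifying their codes.
⌜_⌝ : Fml → Term
⌜ atom p ts ⌝ = fun 0 (fun p ts ∷ [])
⌜ ¬ᶠ A ⌝      = fun 1 (⌜ A ⌝ ∷ [])
⌜ A ∧ᶠ B ⌝    = fun 2 (⌜ A ⌝ ∷ ⌜ B ⌝ ∷ [])
⌜ A ∨ᶠ B ⌝    = fun 3 (⌜ A ⌝ ∷ ⌜ B ⌝ ∷ [])

decode : Term → Fml
decode (fun 0 (fun p ts ∷ [])) = atom p ts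
decode (fun 1 (t ∷ []))        = ¬ᶠ decode t
decode (fun 2 (t ∷ u ∷ []))    = decode t ∧ᶠ decode u
decode (fun 3 (t ∷ u ∷ []))    = decode t ∨ᶠ decode u
decode _                       = atom 0 []

decode-⌜⌝ : ∀ A → decode ⌜ A ⌝ ≡ A
decode-⌜⌝ (atom p ts) = refl
decode-⌜⌝ (¬ᶠ A)      = cong ¬ᶠ_ (decode-⌜⌝ A)
decode-⌜⌝ (A ∧ᶠ B)    = cong₂ _∧ᶠ_ (decode-⌜⌝ A) (decode-⌜⌝ B)
decode-⌜⌝ (A ∨ᶠ B)    = cong₂ _∨ᶠ_ (decode-⌜⌝ A) (decode-⌜⌝ B)

⌜⌝-injective : ∀ {A B} → ⌜ A ⌝ ≡ ⌜ B ⌝ → A ≡ B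
⌜⌝-injective {A} {B} p = trans (sym (decode-⌜⌝ A)) (trans (cong decode p) (decode-⌜⌝ B))

⌜⌝-sub : ∀ σ A → ⌜ A ⟨ σ ⟩ ⌝ ≡ ⌜ A ⌝ ⟨ σ ⟩ₜ
⌜⌝-sub σ (atom p ts) = refl
⌜⌝-sub σ (¬ᶠ A)      = cong (λ t → fun 1 (t ∷ [])) (⌜⌝-sub σ A)
⌜⌝-sub σ (A ∧ᶠ B)    = cong₂ (λ t u → fun 2 (t ∷ u ∷ [])) (⌜⌝-sub σ A) (⌜⌝-sub σ B)
⌜⌝-sub σ (A ∨ᶠ B)    = cong₂ (λ t u → fun 3 (t ∷ u ∷ [])) (⌜⌝-sub σ A) (⌜⌝-sub σ B)

⌜⌝-vars : ∀ {P : ℕ → Set} A → All P (vars A) → All P (varsₜ ⌜ A ⌝)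
⌜⌝-vars (atom p ts) h = All-++⁺ h []
⌜⌝-vars (¬ᶠ A)      h = All-++⁺ (⌜⌝-vars A h) []
⌜⌝-vars (A ∧ᶠ B)    h =
  All-++⁺ (⌜⌝-vars A (All-++⁻ˡ (vars A) h)) (All-++⁺ (⌜⌝-vars B (All-++⁻ʳ (vars A) h)) [])
⌜⌝-vars (A ∨ᶠ B)    h =
  All-++⁺ (⌜⌝-vars A (All-++⁻ˡ (vars A) h)) (All-++⁺ (⌜⌝-vars B (All-++⁻ʳ (vars A) h)) [])

member-vars : ∀ {G Γ} → G ∈ Γ → All (_∈ vars* Γ) (vars G)
member-vars {Γ = A ∷ Γ} (here refl) = All.tabulate ++⁺ˡ
member-vars {Γ = A ∷ Γ} (there G∈)  = All.map (++⁺ʳ (vars A)) (member-vars G∈)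

_≐all_ : Fml → List Fml → List Eqn
F ≐all []      = []
F ≐all (G ∷ L) = (⌜ F ⌝ , ⌜ G ⌝) ∷ F ≐all L

≐all-solves : ∀ {σ} F L → All (λ G → F ⟨ σ ⟩ ≡ G ⟨ σ ⟩) L → Solves σ (F ≐all L)
≐all-solves {σ} F []      []       = []
≐all-solves {σ} F (G ∷ L) (p ∷ ps) =
  trans (sym (⌜⌝-sub σ F)) (trans (cong ⌜_⌝ p) (⌜⌝-sub σ G)) ∷ ≐all-solves F L ps

≐all-solved : ∀ {σ} F L → Solves σ (F ≐all L) → All (λ G → F ⟨ σ ⟩ ≡ G ⟨ σ ⟩) L
≐all-solved {σ} F []      []       = []
≐all-solved {σ} F (G ∷ L) (p ∷ ps) =
  ⌜⌝-injective (trans (⌜⌝-sub σ F) (trans p (sym (⌜⌝-sub σ G)))) ∷ ≐all-solved F L ps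

≐all-inScope : ∀ {S} F L → All (_∈ S) (vars F) → (∀ {G} → G ∈ L → All (_∈ S) (vars G)) →
               InScope S (F ≐all L)
≐all-inScope F []      sF sL = []
≐all-inScope F (G ∷ L) sF sL =
  (⌜⌝-vars F sF , ⌜⌝-vars G (sL (here refl))) ∷ ≐all-inScope F L sF (λ G∈ → sL (there G∈))

unifier⇒solves : ∀ {τ} F Gs → Unifier τ (F ∷ Gs) → Solves τ (F ≐all (F ∷ Gs))
unifier⇒solves F Gs u = ≐all-solves F (F ∷ Gs) (All.tabulate (u (here refl)))

solves⇒unifier : ∀ {θ} F Gs → Solves θ (F ≐all (F ∷ Gs)) → Unifier θ (F ∷ Gs)
solves⇒unifier F Gs solved G∈ H∈ =
  trans (sym (All.lookup eqs G∈)) (All.lookup eqs H∈)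
  where eqs = ≐all-solved F (F ∷ Gs) solved

mgu-exists : ∀ Fs σ → Unifier σ Fs → Σ Subst λ θ → MGU θ Fs
mgu-exists []       σ u = var , (λ ()) , λ τ _ → τ , λ x → refl
mgu-exists (F ∷ Gs) σ u with unify (length S) (size E) S E ≤-refl ≤-refl scope σ (unifier⇒solves F Gs u)
  where
  S = vars* (F ∷ Gs)
  E = F ≐all (F ∷ Gs)
  scope : InScope S E
  scope = ≐all-inScope F (F ∷ Gs) (member-vars {Γ = F ∷ Gs} (here refl)) (member-vars {Γ = F ∷ Gs})
... | θ , solved , general =
  θ , solves⇒unifier F Gs solved , λ τ uτ → general τ (unifier⇒solves F Gs uτ)

shift : ℕ → Subst
shift N x = var (x + N)

below-or-shifted : ∀ N y → y < N ⊎ Σ ℕ λ x → y ≡ x + N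
below-or-shifted N y with y <? N
... | yes y<N = inj₁ y<N
... | no  y≮N = inj₂ (y ∸ N , sym (m∸n+n≡m (≮⇒≥ y≮N)))

glue : ℕ → Subst → Subst → Subst
glue N σ₁ σ₂ y with y <? N
... | yes _ = σ₁ y
... | no  _ = σ₂ (y ∸ N)

glue-lo : ∀ N σ₁ σ₂ {y} → y < N → glue N σ₁ σ₂ y ≡ σ₁ y
glue-lo N σ₁ σ₂ {y} y<N with y <? N
... | yes _   = refl
... | no  y≮N = ⊥-elim (y≮N y<N)

glue-hi : ∀ N σ₁ σ₂ x → glue N σ₁ σ₂ (x + N) ≡ σ₂ x
glue-hi N σ₁ σ₂ x with x + N <? N
... | yes x+N<N = ⊥-elim (m+n≮n x N x+N<N)
... | no  _     = cong σ₂ (m+n∸n≡m x N)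

shifted : ℕ → Subst → Subst
shifted N θ = glue N var (θ ∘ₛ shift N)

shifted-comm : ∀ N θ A → A ⟨ shift N ⟩ ⟨ shifted N θ ⟩ ≡ A ⟨ θ ⟩ ⟨ shift N ⟩
shifted-comm N θ A = trans (comp A) (trans (agree A (All.universal (glue-hi N var _) _)) (sym (comp A)))

shifted-comm* : ∀ N θ Γ → Γ ⟨ shift N ⟩* ⟨ shifted N θ ⟩* ≡ Γ ⟨ θ ⟩* ⟨ shift N ⟩*
shifted-comm* N θ Γ = trans (comp* Γ) (trans (agree* Γ (All.universal (glue-hi N var _) _)) (sym (comp* Γ)))

mgu-shift : ∀ N {θ} Fs → MGU θ Fs → MGU (shifted N θ) (Fs ⟨ shift N ⟩*)
mgu-shift N {θ} Fs (unifies , general) = unifies′ , general′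
  where
  open ≡-Reasoning
  unifies′ : Unifier (shifted N θ) (Fs ⟨ shift N ⟩*)
  unifies′ X∈ Y∈ with ∈-map⁻ (_⟨ shift N ⟩) X∈ | ∈-map⁻ (_⟨ shift N ⟩) Y∈
  ... | X , X∈Fs , refl | Y , Y∈Fs , refl =
    trans (shifted-comm N θ X) (trans (cong (_⟨ shift N ⟩) (unifies X∈Fs Y∈Fs)) (sym (shifted-comm N θ Y)))
  general′ : ∀ τ → Unifier τ (Fs ⟨ shift N ⟩*) → shifted N θ ≼ τ
  general′ τ uτ with general (shift N ∘ₛ τ) (λ {X} {Y} X∈ Y∈ →
    trans (sym (comp X)) (trans (uτ (∈-map⁺ (_⟨ shift N ⟩) X∈) (∈-map⁺ (_⟨ shift N ⟩) Y∈)) (comp Y)))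
  ... | ρ₀ , τ≡θρ₀ = ρ , factor
    where
    ρ = glue N τ ρ₀
    factor : ∀ y → τ y ≡ shifted N θ y ⟨ ρ ⟩ₜ
    factor y with below-or-shifted N y
    ... | inj₁ y<N = trans (sym (glue-lo N τ ρ₀ y<N)) (cong (_⟨ ρ ⟩ₜ) (sym (glue-lo N var _ y<N)))
    ... | inj₂ (x , refl) = begin
      τ (x + N)                      ≡⟨ τ≡θρ₀ x ⟩
      θ x ⟨ ρ₀ ⟩ₜ                    ≡⟨ agreeₜ (θ x) (All.universal (λ z → sym (glue-hi N τ ρ₀ z)) _) ⟩
      θ x ⟨ shift N ∘ₛ ρ ⟩ₜ          ≡⟨ sym (compₜ (θ x)) ⟩
      θ x ⟨ shift N ⟩ₜ ⟨ ρ ⟩ₜ        ≡⟨ cong (_⟨ ρ ⟩ₜ) (sym (glue-hi N var _ x)) ⟩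
      shifted N θ (x + N) ⟨ ρ ⟩ₜ     ∎

vars-shift : ∀ N Γ → All (λ x → Σ ℕ λ y → x ≡ y + N × y ∈ vars* Γ) (vars* (Γ ⟨ shift N ⟩*))
vars-shift N Γ = varsSub* (shift N) Γ (All.tabulate λ {y} y∈ → (y , refl , y∈) ∷ [])

shift-disjoint : ∀ N {As Bs} → (∀ {x} → x ∈ vars* As → x ∉ vars* Bs) →
                 ∀ {x} → x ∈ vars* (As ⟨ shift N ⟩*) → x ∉ vars* (Bs ⟨ shift N ⟩*)
shift-disjoint N {As} {Bs} disjoint x∈ x∈′
  with All.lookup (vars-shift N As) x∈ | All.lookup (vars-shift N Bs) x∈′
... | y , refl , y∈ | y′ , y+N≡y′+N , y′∈ =
  disjoint y∈ (subst (_∈ vars* Bs) (sym (+-cancelʳ-≡ N y y′ y+N≡y′+N)) y′∈)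

module _ {Ax : Seq → Set}
         (Ax-shift : ∀ N {Γ Δ} → Ax (Γ ⊢ Δ) → Ax (Γ ⟨ shift N ⟩* ⊢ Δ ⟨ shift N ⟩*)) where

  shiftDer : ∀ N {Γ Δ} → Der Ax (Γ ⊢ Δ) → Der Ax (Γ ⟨ shift N ⟩* ⊢ Δ ⟨ shift N ⟩*)
  shiftDer N (axiom ax)               = axiom (Ax-shift N ax)
  shiftDer N (perm p q d)             = perm (↭-map⁺ _ p) (↭-map⁺ _ q) (shiftDer N d)
  shiftDer N (rule ∧R₁ (d ∷ []))      = rule ∧R₁ (shiftDer N d ∷ [])
  shiftDer N (rule ∧R₂ (d ∷ []))      = rule ∧R₂ (shiftDer N d ∷ [])
  shiftDer N (rule ∧L (d ∷ []))       = rule ∧L (shiftDer N d ∷ [])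
  shiftDer N (rule ∨R (d ∷ []))       = rule ∨R (shiftDer N d ∷ [])
  shiftDer N (rule ∨L₁ (d ∷ []))      = rule ∨L₁ (shiftDer N d ∷ [])
  shiftDer N (rule ∨L₂ (d ∷ []))      = rule ∨L₂ (shiftDer N d ∷ [])
  shiftDer N (rule ¬R (d ∷ []))       = rule ¬R (shiftDer N d ∷ [])
  shiftDer N (rule ¬L (d ∷ []))       = rule ¬L (shiftDer N d ∷ [])
  shiftDer N (rule (res {Γ} {Δ} {Π} {Λ} {A} {B} {As} {Bs} {θ} disjoint mgu) (d₁ ∷ d₂ ∷ [])) =
    subst (Der Ax) (cong₂ _⊢_ (shifted-conclusion Γ Π) (shifted-conclusion Δ Λ))
      (rule (res (shift-disjoint N {A ∷ As} {B ∷ Bs} disjoint)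
                 (subst (MGU (shifted N θ)) (map-++ _ (A ∷ As) (B ∷ Bs)) (mgu-shift N _ mgu)))
            (subst (λ L → Der Ax (Γ ⟨ shift N ⟩* ⊢ L)) (map-++ _ Δ (A ∷ As)) (shiftDer N d₁)
             ∷ subst (λ L → Der Ax (L ⊢ Λ ⟨ shift N ⟩*)) (map-++ _ (B ∷ Bs) Π) (shiftDer N d₂) ∷ []))
    where
    shifted-conclusion : ∀ L₁ L₂ →
      (L₁ ⟨ shift N ⟩* ++ L₂ ⟨ shift N ⟩*) ⟨ shifted N θ ⟩* ≡ (L₁ ++ L₂) ⟨ θ ⟩* ⟨ shift N ⟩*
    shifted-conclusion L₁ L₂ =
      trans (cong (_⟨ shifted N θ ⟩*) (sym (map-++ _ L₁ L₂))) (shifted-comm* N θ (L₁ ++ L₂))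

renamed-shift : ∀ F N {Γ Δ} → RenamedAxioms F (Γ ⊢ Δ) →
                RenamedAxioms F (Γ ⟨ shift N ⟩* ⊢ Δ ⟨ shift N ⟩*)
renamed-shift F N (θ , (r , r-injective , θ≡r) , refl) =
  θ ∘ₛ shift N ,
  ((λ x → r x + N) , (λ e → r-injective (+-cancelʳ-≡ N _ _ e)) , (λ x → cong (_⟨ shift N ⟩ₜ) (θ≡r x))) ,
  cong (λ A → [] ⊢ A ∷ []) (comp F)

bound : List ℕ → ℕ
bound xs = suc (max 0 xs)

below-bound : ∀ xs → All (_< bound xs) xs
below-bound xs = All.map s≤s (xs≤max 0 xs)

++-map-inv : ∀ {A B : Set} (f : A → B) xs {ys} Z → xs ++ ys ≡ map f Z →
             Σ (List A) λ Z₁ → Σ (List A) λ Z₂ → Z ≡ Z₁ ++ Z₂ × xs ≡ map f Z₁ × ys ≡ map f Z₂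
++-map-inv f []       Z       e = [] , Z , refl , refl , e
++-map-inv f (x ∷ xs) (z ∷ Z) e with ∷-injective e
... | x≡ , e′ with ++-map-inv f xs Z e′
...   | Z₁ , Z₂ , refl , refl , refl = z ∷ Z₁ , Z₂ , refl , cong (_∷ _) x≡ , refl

pick : ∀ {L σ C Δ} → L ⟨ σ ⟩* ↭ C ∷ Δ →
       Σ Fml λ X → Σ (List Fml) λ Y → (L ↭ X ∷ Y) × X ⟨ σ ⟩ ≡ C × Y ⟨ σ ⟩* ≡ Δ
pick {σ = σ} p with ↭-map-inv (_⟨ σ ⟩) p
... | X ∷ Y , e , q with ∷-injective e
...   | C≡ , Δ≡ = X , Y , q , sym C≡ , sym Δ≡

module Lifting {Ax : Seq → Set}
               (Ax-shift : ∀ N {Γ Δ} → Ax (Γ ⊢ Δ) → Ax (Γ ⟨ shift N ⟩* ⊢ Δ ⟨ shift N ⟩*)) where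

  record Instance (Γ Δ : List Fml) : Set where
    constructor inst
    field
      Γ₀ Δ₀ : List Fml
      σ     : Subst
      der   : Der Ax (Γ₀ ⊢ Δ₀)
      Γ≈    : Γ₀ ⟨ σ ⟩* ↭ Γ
      Δ≈    : Δ₀ ⟨ σ ⟩* ↭ Δ

  inst-perm : ∀ {Γ Γ′ Δ Δ′} → Γ ↭ Γ′ → Δ ↭ Δ′ → Instance Γ Δ → Instance Γ′ Δ′
  inst-perm p q (inst Γ₀ Δ₀ σ d Γ≈ Δ≈) = inst Γ₀ Δ₀ σ d (↭-trans Γ≈ p) (↭-trans Δ≈ q)

  -- the one-premise rules: an instance of the premise yields one of the
  -- conclusion, since the principal formula comes from one of the same shape
  inst-∧R₁ : ∀ {Γ A B Δ} → Instance Γ ((A ∧ᶠ B) ∷ Δ) → Instance Γ (A ∷ Δ)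
  inst-∧R₁ (inst Γ₀ Δ₀ σ d Γ≈ Δ≈) with pick Δ≈
  ... | X₁ ∧ᶠ X₂ , Y , q , refl , refl = inst Γ₀ (X₁ ∷ Y) σ (rule ∧R₁ (perm ↭-refl q d ∷ [])) Γ≈ ↭-refl

  inst-∧R₂ : ∀ {Γ A B Δ} → Instance Γ ((A ∧ᶠ B) ∷ Δ) → Instance Γ (B ∷ Δ)
  inst-∧R₂ (inst Γ₀ Δ₀ σ d Γ≈ Δ≈) with pick Δ≈
  ... | X₁ ∧ᶠ X₂ , Y , q , refl , refl = inst Γ₀ (X₂ ∷ Y) σ (rule ∧R₂ (perm ↭-refl q d ∷ [])) Γ≈ ↭-refl

  inst-∨R : ∀ {Γ A B Δ} → Instance Γ ((A ∨ᶠ B) ∷ Δ) → Instance Γ (A ∷ B ∷ Δ)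
  inst-∨R (inst Γ₀ Δ₀ σ d Γ≈ Δ≈) with pick Δ≈
  ... | (X₁ ∨ᶠ X₂) , Y , q , refl , refl = inst Γ₀ (X₁ ∷ X₂ ∷ Y) σ (rule ∨R (perm ↭-refl q d ∷ [])) Γ≈ ↭-refl

  inst-¬R : ∀ {Γ A Δ} → Instance Γ ((¬ᶠ A) ∷ Δ) → Instance (A ∷ Γ) Δ
  inst-¬R (inst Γ₀ Δ₀ σ d Γ≈ Δ≈) with pick Δ≈
  ... | ¬ᶠ X , Y , q , refl , refl = inst (X ∷ Γ₀) Y σ (rule ¬R (perm ↭-refl q d ∷ [])) (prep _ Γ≈) ↭-refl

  inst-∧L : ∀ {Γ A B Δ} → Instance ((A ∧ᶠ B) ∷ Γ) Δ → Instance (A ∷ B ∷ Γ) Δ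
  inst-∧L (inst Γ₀ Δ₀ σ d Γ≈ Δ≈) with pick Γ≈
  ... | X₁ ∧ᶠ X₂ , Y , q , refl , refl = inst (X₁ ∷ X₂ ∷ Y) Δ₀ σ (rule ∧L (perm q ↭-refl d ∷ [])) ↭-refl Δ≈

  inst-∨L₁ : ∀ {Γ A B Δ} → Instance ((A ∨ᶠ B) ∷ Γ) Δ → Instance (A ∷ Γ) Δ
  inst-∨L₁ (inst Γ₀ Δ₀ σ d Γ≈ Δ≈) with pick Γ≈
  ... | (X₁ ∨ᶠ X₂) , Y , q , refl , refl = inst (X₁ ∷ Y) Δ₀ σ (rule ∨L₁ (perm q ↭-refl d ∷ [])) ↭-refl Δ≈

  inst-∨L₂ : ∀ {Γ A B Δ} → Instance ((A ∨ᶠ B) ∷ Γ) Δ → Instance (B ∷ Γ) Δ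
  inst-∨L₂ (inst Γ₀ Δ₀ σ d Γ≈ Δ≈) with pick Γ≈
  ... | (X₁ ∨ᶠ X₂) , Y , q , refl , refl = inst (X₂ ∷ Y) Δ₀ σ (rule ∨L₂ (perm q ↭-refl d ∷ [])) ↭-refl Δ≈

  inst-¬L : ∀ {Γ A Δ} → Instance ((¬ᶠ A) ∷ Γ) Δ → Instance Γ (A ∷ Δ)
  inst-¬L (inst Γ₀ Δ₀ σ d Γ≈ Δ≈) with pick Γ≈
  ... | ¬ᶠ X , Y , q , refl , refl = inst Y (X ∷ Δ₀) σ (rule ¬L (perm q ↭-refl d ∷ [])) ↭-refl (prep _ Δ≈)

  -- Lifting lemma for resolution: if instances of the resolved formulas of
  -- two derivable sequents all coincide, then shifting the second apart and
  -- resolving on an mgu derives a sequent having the resolvent as an instance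
  resolve-lifted : ∀ {C} Γ₀ Y₁ A As B Bs Z₂ Λ₀ σ₁ σ₂ →
    Der Ax (Γ₀ ⊢ Y₁ ++ (A ∷ As)) → Der Ax ((B ∷ Bs) ++ Z₂ ⊢ Λ₀) →
    All (_≡ C) ((A ∷ As) ⟨ σ₁ ⟩* ++ (B ∷ Bs) ⟨ σ₂ ⟩*) →
    Instance (Γ₀ ⟨ σ₁ ⟩* ++ Z₂ ⟨ σ₂ ⟩*) (Y₁ ⟨ σ₁ ⟩* ++ Λ₀ ⟨ σ₂ ⟩*)
  resolve-lifted {C} Γ₀ Y₁ A As B Bs Z₂ Λ₀ σ₁ σ₂ d₁ d₂ all-C =
    inst _ _ ρ resolvent (↭-reflexive (factor Γ₀ Z₂ lowΓ)) (↭-reflexive (factor Y₁ Λ₀ lowY))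
    where
    -- the variables of the left premise are below N; the right one is shifted past N
    N = bound (vars* Γ₀ ++ (vars* Y₁ ++ vars* (A ∷ As)))
    low = below-bound (vars* Γ₀ ++ (vars* Y₁ ++ vars* (A ∷ As)))
    lowΓ = All-++⁻ˡ (vars* Γ₀) low
    lowY = All-++⁻ˡ (vars* Y₁) (All-++⁻ʳ (vars* Γ₀) low)
    lowA = All-++⁻ʳ (vars* Y₁) (All-++⁻ʳ (vars* Γ₀) low)
    s = shift N
    -- σ acts as σ₁ on the left premise and as σ₂ on the shifted right premise
    σ = glue N σ₁ σ₂
    glued : ∀ L₁ L₂ → All (_< N) (vars* L₁) → (L₁ ++ L₂ ⟨ s ⟩*) ⟨ σ ⟩* ≡ L₁ ⟨ σ₁ ⟩* ++ L₂ ⟨ σ₂ ⟩*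
    glued L₁ L₂ lowL₁ = trans (map-++ _ L₁ (L₂ ⟨ s ⟩*))
      (cong₂ _++_ (agree* L₁ (All.map (glue-lo N σ₁ σ₂) lowL₁))
                  (trans (comp* L₂) (agree* L₂ (All.universal (glue-hi N σ₁ σ₂) _))))
    Fs = (A ∷ As) ++ (B ∷ Bs) ⟨ s ⟩*
    σ-unifies : Unifier σ Fs
    σ-unifies X∈ Y∈ = trans (All.lookup C-instances X∈) (sym (All.lookup C-instances Y∈))
      where C-instances = map⁻ (subst (All (_≡ C)) (sym (glued (A ∷ As) (B ∷ Bs) lowA)) all-C)
    mgu = mgu-exists Fs σ σ-unifies
    θ = proj₁ mgu
    ρ = proj₁ (proj₂ (proj₂ mgu) σ σ-unifies)
    σ≡θρ = proj₂ (proj₂ (proj₂ mgu) σ σ-unifies)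
    disjoint : ∀ {x} → x ∈ vars* (A ∷ As) → x ∉ vars* ((B ∷ Bs) ⟨ s ⟩*)
    disjoint x∈ x∈′ with All.lookup (vars-shift N (B ∷ Bs)) x∈′
    ... | y , refl , _ = <⇒≱ (All.lookup lowA x∈) (m≤n+m N y)
    resolvent : Der Ax ((Γ₀ ++ Z₂ ⟨ s ⟩*) ⟨ θ ⟩* ⊢ (Y₁ ++ Λ₀ ⟨ s ⟩*) ⟨ θ ⟩*)
    resolvent = rule (res disjoint (proj₂ mgu))
      (d₁ ∷ subst (λ L → Der Ax (L ⊢ Λ₀ ⟨ s ⟩*)) (map-++ _ (B ∷ Bs) Z₂) (shiftDer Ax-shift N d₂) ∷ [])
    factor : ∀ L₁ L₂ → All (_< N) (vars* L₁) →
             (L₁ ++ L₂ ⟨ s ⟩*) ⟨ θ ⟩* ⟨ ρ ⟩* ≡ L₁ ⟨ σ₁ ⟩* ++ L₂ ⟨ σ₂ ⟩*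
    factor L₁ L₂ lowL₁ = trans (comp* (L₁ ++ L₂ ⟨ s ⟩*))
      (trans (agree* (L₁ ++ L₂ ⟨ s ⟩*) (All.universal (λ x → sym (σ≡θρ x)) _)) (glued L₁ L₂ lowL₁))

  inst-resolve : ∀ {Γ Δ Π Λ C Cs Ds} → All (_≡ C) Cs → All (_≡ C) Ds →
                 Instance Γ (Δ ++ (C ∷ Cs)) → Instance ((C ∷ Ds) ++ Π) Λ → Instance (Γ ++ Π) (Δ ++ Λ)
  inst-resolve {Δ = Δ} {C = C} {Ds = Ds} Cs≡C Ds≡C (inst Γ₀ Δ₀ σ₁ d₁ Γ≈ Δ≈) (inst Π₀ Λ₀ σ₂ d₂ Π≈ Λ≈)
    with ↭-map-inv (_⟨ σ₁ ⟩) Δ≈ | ↭-map-inv (_⟨ σ₂ ⟩) Π≈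
  ... | Y , eY , qY | Z , eZ , qZ
    with ++-map-inv (_⟨ σ₁ ⟩) Δ Y eY | ++-map-inv (_⟨ σ₂ ⟩) (C ∷ Ds) Z eZ
  ... | Y₁ , A ∷ As , refl , refl , eA | B ∷ Bs , Z₂ , refl , eB , refl =
    inst-perm (↭-++⁺ Γ≈ ↭-refl) (↭-++⁺ ↭-refl Λ≈)
      (resolve-lifted Γ₀ Y₁ A As B Bs Z₂ Λ₀ σ₁ σ₂ (perm ↭-refl qY d₁) (perm qZ ↭-refl d₂)
        (All-++⁺ (subst (All (_≡ C)) eA (refl ∷ Cs≡C)) (subst (All (_≡ C)) eB (refl ∷ Ds≡C))))

-- Coding atoms by natural numbers (Cantor pairing), so that the atoms of
-- the Herbrand universe can be enumerated

triangle : ℕ → ℕ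
triangle zero    = 0
triangle (suc n) = suc n + triangle n

triangle-mono : ∀ {m n} → m ≤ n → triangle m ≤ triangle n
triangle-mono z≤n     = z≤n
triangle-mono (s≤s p) = +-mono-≤ (s≤s p) (triangle-mono p)

pair : ℕ → ℕ → ℕ
pair a b = triangle (a + b) + b

pair-< : ∀ a b c d → a + b < c + d → pair a b < pair c d
pair-< a b c d a+b<c+d = begin-strict
  triangle (a + b) + b             <⟨ s≤s (+-monoʳ-≤ (triangle (a + b)) (m≤n+m b a)) ⟩
  suc (triangle (a + b) + (a + b)) ≡⟨ cong suc (+-comm (triangle (a + b)) (a + b)) ⟩
  triangle (suc (a + b))           ≤⟨ triangle-mono a+b<c+d ⟩
  triangle (c + d)                 ≤⟨ m≤m+n (triangle (c + d)) d ⟩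
  pair c d                         ∎
  where open ≤-Reasoning

pair-injective : ∀ a b c d → pair a b ≡ pair c d → a ≡ c × b ≡ d
pair-injective a b c d e with <-cmp (a + b) (c + d)
... | tri< lt _ _ = ⊥-elim (<-irrefl e (pair-< a b c d lt))
... | tri> _ _ gt = ⊥-elim (<-irrefl (sym e) (pair-< c d a b gt))
... | tri≈ _ same _ = a≡c , b≡d
  where
  b≡d : b ≡ d
  b≡d = +-cancelˡ-≡ (triangle (a + b)) b d (trans e (cong (λ n → triangle n + d) (sym same)))
  a≡c : a ≡ c
  a≡c = +-cancelʳ-≡ b a c (trans same (cong (c +_) (sym b≡d)))

mutual
  termCode : Term → ℕ
  termCode (var x)    = pair 0 x
  termCode (fun f ts) = pair (suc f) (termsCode ts)

  termsCode : List Term → ℕ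
  termsCode []       = 0
  termsCode (t ∷ ts) = suc (pair (termCode t) (termsCode ts))

mutual
  termCode-injective : ∀ t u → termCode t ≡ termCode u → t ≡ u
  termCode-injective (var x) (var y) e = cong var (proj₂ (pair-injective 0 x 0 y e))
  termCode-injective (var x) (fun g us) e with pair-injective 0 x (suc g) (termsCode us) e
  ... | () , _
  termCode-injective (fun f ts) (var y) e with pair-injective (suc f) (termsCode ts) 0 y e
  ... | () , _
  termCode-injective (fun f ts) (fun g us) e with pair-injective (suc f) (termsCode ts) (suc g) (termsCode us) e
  ... | refl , e′ = cong (fun f) (termsCode-injective ts us e′)

  termsCode-injective : ∀ ts us → termsCode ts ≡ termsCode us → ts ≡ us
  termsCode-injective []       []       e = refl
  termsCode-injective (t ∷ ts) (u ∷ us) e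
    with pair-injective (termCode t) (termsCode ts) (termCode u) (termsCode us) (suc-injective e)
  ... | e₁ , e₂ = cong₂ _∷_ (termCode-injective t u e₁) (termsCode-injective ts us e₂)

atomCode : ℕ → List Term → ℕ
atomCode p ts = pair p (termsCode ts)

atomCode-injective : ∀ p ts q us → atomCode p ts ≡ atomCode q us → atom p ts ≡ atom q us
atomCode-injective p ts q us e with pair-injective p (termsCode ts) q (termsCode us) e
... | refl , e′ = cong (atom p) (termsCode-injective ts us e′)

Val : Set
Val = ℕ → Bool

herbrand : Val → Structure
herbrand v = record { D = Term ; d₀ = var 0 ; funI = fun ; relI = λ p ts → v (atomCode p ts) }

value : Val → Fml → Bool
value v (atom p ts) = v (atomCode p ts)
value v (¬ᶠ A)      = not (value v A)
value v (A ∧ᶠ B)    = value v A ∧ value v B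
value v (A ∨ᶠ B)    = value v A ∨ value v B

mutual
  herbrand-evalₜ : ∀ v a t → evalₜ (herbrand v) a t ≡ t ⟨ a ⟩ₜ
  herbrand-evalₜ v a (var x)    = refl
  herbrand-evalₜ v a (fun f ts) = cong (fun f) (herbrand-evalₜₛ v a ts)

  herbrand-evalₜₛ : ∀ v a ts → evalₜₛ (herbrand v) a ts ≡ ts ⟨ a ⟩ₜₛ
  herbrand-evalₜₛ v a []       = refl
  herbrand-evalₜₛ v a (t ∷ ts) = cong₂ _∷_ (herbrand-evalₜ v a t) (herbrand-evalₜₛ v a ts)

herbrand-eval : ∀ v a A → eval (herbrand v) a A ≡ value v (A ⟨ a ⟩)
herbrand-eval v a (atom p ts) = cong (λ us → v (atomCode p us)) (herbrand-evalₜₛ v a ts)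
herbrand-eval v a (¬ᶠ A)      = cong not (herbrand-eval v a A)
herbrand-eval v a (A ∧ᶠ B)    = cong₂ _∧_ (herbrand-eval v a A) (herbrand-eval v a B)
herbrand-eval v a (A ∨ᶠ B)    = cong₂ _∨_ (herbrand-eval v a A) (herbrand-eval v a B)

codes : Fml → List ℕ
codes (atom p ts) = atomCode p ts ∷ []
codes (¬ᶠ A)      = codes A
codes (A ∧ᶠ B)    = codes A ++ codes B
codes (A ∨ᶠ B)    = codes A ++ codes B

value-agree : ∀ v w n A → (∀ {c} → c < n → v c ≡ w c) → All (_< n) (codes A) → value v A ≡ value w A
value-agree v w n (atom p ts) agree (c<n ∷ []) = agree c<n
value-agree v w n (¬ᶠ A)      agree lows = cong not (value-agree v w n A agree lows)
value-agree v w n (A ∧ᶠ B)    agree lows = cong₂ _∧_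
  (value-agree v w n A agree (All-++⁻ˡ (codes A) lows)) (value-agree v w n B agree (All-++⁻ʳ (codes A) lows))
value-agree v w n (A ∨ᶠ B)    agree lows = cong₂ _∨_
  (value-agree v w n A agree (All-++⁻ˡ (codes A) lows)) (value-agree v w n B agree (All-++⁻ʳ (codes A) lows))

no-codes-below-0 : ∀ A → ¬ All (_< 0) (codes A)
no-codes-below-0 (atom p ts) (() ∷ [])
no-codes-below-0 (¬ᶠ A)      lows = no-codes-below-0 A lows
no-codes-below-0 (A ∧ᶠ B)    lows = no-codes-below-0 A (All-++⁻ˡ (codes A) lows)
no-codes-below-0 (A ∨ᶠ B)    lows = no-codes-below-0 A (All-++⁻ˡ (codes A) lows)

_[_≔_] : Val → ℕ → Bool → Val
(v [ n ≔ b ]) c with c ≟ n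
... | yes _ = b
... | no  _ = v c

≔-same : ∀ v n b → (v [ n ≔ b ]) n ≡ b
≔-same v n b with n ≟ n
... | yes _   = refl
... | no  n≢n = ⊥-elim (n≢n refl)

≔-other : ∀ v n b {c} → ¬ c ≡ n → (v [ n ≔ b ]) c ≡ v c
≔-other v n b {c} c≢n with c ≟ n
... | yes c≡n = ⊥-elim (c≢n c≡n)
... | no  _   = refl

Holds : Val → ℕ → Bool → Fml → Set
Holds v n b A = All (_< n) (codes A) × value v A ≡ b

data Atomic : Fml → Set where
  atomic : ∀ {p ts} → Atomic (atom p ts)

AtomHolds : Val → ℕ → Bool → Fml → Set
AtomHolds v n b A = Atomic A × Holds v n b A

module SemanticTree {Ax : Seq → Set}
                    (Ax-shift : ∀ N {Γ Δ} → Ax (Γ ⊢ Δ) → Ax (Γ ⟨ shift N ⟩* ⊢ Δ ⟨ shift N ⟩*)) where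
  open Lifting Ax-shift

  Falsified : (Bool → Fml → Set) → Set
  Falsified holds = Σ (List Fml) λ G → Σ (List Fml) λ H →
                    Instance G H × All (holds true) G × All (holds false) H

  Closed AtomicallyClosed : Val → ℕ → Set
  Closed v n           = Falsified (Holds v n)
  AtomicallyClosed v n = Falsified (AtomHolds v n)

  module _ {v : Val} {n : ℕ} where
    Atomizable : List Fml → List Fml → Set
    Atomizable Γ Δ = ∀ {AΓ AΔ} → All (AtomHolds v n true) AΓ → All (AtomHolds v n false) AΔ →
                     Instance (Γ ++ AΓ) (Δ ++ AΔ) → AtomicallyClosed v n

    mutual
      atomizeˡ : ∀ A {Γ Δ} → Holds v n true A → Atomizable Γ Δ → Atomizable (A ∷ Γ) Δ
      atomizeˡ (atom p ts) {Γ} h k {AΓ} aΓ aΔ I =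
        k ((atomic , h) ∷ aΓ) aΔ (inst-perm (↭-sym (↭-shift (atom p ts) Γ AΓ)) ↭-refl I)
      atomizeˡ (¬ᶠ A)   (lows , e) k aΓ aΔ I = atomizeʳ A (lows , not-injective e) k aΓ aΔ (inst-¬L I)
      atomizeˡ (A ∧ᶠ B) (lows , e) k aΓ aΔ I =
        atomizeˡ A (All-++⁻ˡ (codes A) lows , ∧-conicalˡ _ _ e)
          (atomizeˡ B (All-++⁻ʳ (codes A) lows , ∧-conicalʳ _ _ e) k) aΓ aΔ (inst-∧L I)
      atomizeˡ (A ∨ᶠ B) (lows , e) k aΓ aΔ I with ∨-true-split (value v A) e
      ... | inj₁ eA = atomizeˡ A (All-++⁻ˡ (codes A) lows , eA) k aΓ aΔ (inst-∨L₁ I)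
      ... | inj₂ eB = atomizeˡ B (All-++⁻ʳ (codes A) lows , eB) k aΓ aΔ (inst-∨L₂ I)

      atomizeʳ : ∀ A {Γ Δ} → Holds v n false A → Atomizable Γ Δ → Atomizable Γ (A ∷ Δ)
      atomizeʳ (atom p ts) {Δ = Δ} h k {AΔ = AΔ} aΓ aΔ I =
        k aΓ ((atomic , h) ∷ aΔ) (inst-perm ↭-refl (↭-sym (↭-shift (atom p ts) Δ AΔ)) I)
      atomizeʳ (¬ᶠ A)   (lows , e) k aΓ aΔ I = atomizeˡ A (lows , not-injective e) k aΓ aΔ (inst-¬R I)
      atomizeʳ (A ∧ᶠ B) (lows , e) k aΓ aΔ I with ∧-false-split (value v A) e
      ... | inj₁ eA = atomizeʳ A (All-++⁻ˡ (codes A) lows , eA) k aΓ aΔ (inst-∧R₁ I)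
      ... | inj₂ eB = atomizeʳ B (All-++⁻ʳ (codes A) lows , eB) k aΓ aΔ (inst-∧R₂ I)
      atomizeʳ (A ∨ᶠ B) (lows , e) k aΓ aΔ I =
        atomizeʳ A (All-++⁻ˡ (codes A) lows , ∨-conicalˡ _ _ e)
          (atomizeʳ B (All-++⁻ʳ (codes A) lows , ∨-conicalʳ _ _ e) k) aΓ aΔ (inst-∨R I)

    atomizable : ∀ Γ Δ → All (Holds v n true) Γ → All (Holds v n false) Δ → Atomizable Γ Δ
    atomizable []      []      []       []       aΓ aΔ I = _ , _ , I , aΓ , aΔ
    atomizable (A ∷ Γ) Δ       (h ∷ hΓ) hΔ       = atomizeˡ A h (atomizable Γ Δ hΓ hΔ)
    atomizable []      (A ∷ Δ) []       (h ∷ hΔ) = atomizeʳ A h (atomizable [] Δ [] hΔ)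

    atomize : Closed v n → AtomicallyClosed v n
    atomize (G , H , I , hG , hH) = atomizable G H hG hH [] []
      (inst-perm (↭-reflexive (sym (++-identityʳ G))) (↭-reflexive (sym (++-identityʳ H))) I)

  CodedAt : ℕ → Fml → Set
  CodedAt n A = Σ ℕ λ p → Σ (List Term) λ ts → A ≡ atom p ts × atomCode p ts ≡ n

  coded-unique : ∀ {n X Y} → CodedAt n X → CodedAt n Y → Y ≡ X
  coded-unique (p , ts , refl , refl) (q , us , refl , e) = atomCode-injective q us p ts e

  lower : ∀ {v n b b′ A} → AtomHolds (v [ n ≔ b ]) (suc n) b′ A → CodedAt n A ⊎ AtomHolds v n b′ A
  lower {v} {n} {b} {A = atom p ts} (atomic , (c<1+n ∷ []) , e) = decide (atomCode p ts ≟ n)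
    where
    decide : Dec (atomCode p ts ≡ n) → CodedAt n (atom p ts) ⊎ AtomHolds v n _ (atom p ts)
    decide (yes c≡n) = inj₁ (p , ts , refl , c≡n)
    decide (no  c≢n) = inj₂ (atomic , (≤∧≢⇒< (≤-pred c<1+n) c≢n ∷ []) , trans (sym (≔-other v n b c≢n)) e)

  lower-other : ∀ {v n b b′} → ¬ b ≡ b′ → ∀ {A} → AtomHolds (v [ n ≔ b ]) (suc n) b′ A → AtomHolds v n b′ A
  lower-other {v} {b = b} b≢b′ h with lower h
  ... | inj₂ h′ = h′
  ... | inj₁ (p , ts , refl , refl) = ⊥-elim (b≢b′ (trans (sym (≔-same v (atomCode p ts) b)) (proj₂ (proj₂ h))))

  separate : ∀ {v n b} L → All (AtomHolds (v [ n ≔ b ]) (suc n) b) L →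
             Σ (List Fml) λ Cs → Σ (List Fml) λ Os →
             (L ↭ Cs ++ Os) × All (CodedAt n) Cs × All (AtomHolds v n b) Os
  separate []      []       = [] , [] , ↭-refl , [] , []
  separate (X ∷ L) (h ∷ hs) with separate L hs | lower h
  ... | Cs , Os , p , cs , os | inj₁ c = X ∷ Cs , Os , prep X p , c ∷ cs , os
  ... | Cs , Os , p , cs , os | inj₂ o = Cs , X ∷ Os , ↭-trans (prep X p) (↭-sym (↭-shift X Cs Os)) , cs , o ∷ os

  holds : ∀ {v n b} → All (AtomHolds v n b) ⊆ All (Holds v n b)
  holds = All.map proj₂

  -- if both children of a node are closed, so is the node: resolve on the atom coded n
  clash : ∀ v n → AtomicallyClosed (v [ n ≔ true ]) (suc n) → AtomicallyClosed (v [ n ≔ false ]) (suc n) →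
          Closed v n
  clash v n (G₁ , H₁ , I₁ , aG₁ , aH₁) (G₂ , H₂ , I₂ , aG₂ , aH₂) with separate G₁ aG₁ | separate H₂ aH₂
  ... | [] , Os₁ , p₁ , _ , os₁ | _ =
    Os₁ , H₁ , inst-perm p₁ ↭-refl I₁ , holds os₁ , holds (All.map (lower-other (λ ())) aH₁)
  ... | _ ∷ _ , _ | [] , Os₂ , p₂ , _ , os₂ =
    G₂ , Os₂ , inst-perm ↭-refl p₂ I₂ , holds (All.map (lower-other (λ ())) aG₂) , holds os₂
  ... | X ∷ Xs , Os₁ , p₁ , cX ∷ cXs , os₁ | Y ∷ Ys , Os₂ , p₂ , cY ∷ cYs , os₂ =
    G₂ ++ Os₁ , Os₂ ++ H₁ ,
    inst-resolve (copies cYs) (copies cXs) I₂′ (inst-perm p₁ ↭-refl I₁) ,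
    All-++⁺ (holds (All.map (lower-other (λ ())) aG₂)) (holds os₁) ,
    All-++⁺ (holds os₂) (holds (All.map (lower-other (λ ())) aH₁))
    where
    copies : ∀ {L} → All (CodedAt n) L → All (_≡ X) L
    copies = All.map (coded-unique cX)
    I₂′ : Instance G₂ (Os₂ ++ (X ∷ Ys))
    I₂′ = inst-perm ↭-refl
      (↭-trans p₂ (↭-trans (↭-++-comm (Y ∷ Ys) Os₂) (↭-reflexive (cong (λ Z → Os₂ ++ (Z ∷ Ys)) (coded-unique cX cY)))))
      I₂

  closed-root : ∀ {v} → Closed v 0 → Der Ax ([] ⊢ [])
  closed-root (A ∷ G , H , _ , (lows , _) ∷ _ , _)      = ⊥-elim (no-codes-below-0 A lows)
  closed-root ([] , A ∷ H , _ , _ , (lows , _) ∷ _)     = ⊥-elim (no-codes-below-0 A lows)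
  closed-root ([] , [] , inst [] [] σ d _ _ , _ , _)    = d
  closed-root ([] , [] , inst (_ ∷ _) _ σ d Γ≈ _ , _ , _) with ↭-empty-inv Γ≈
  ... | ()
  closed-root ([] , [] , inst [] (_ ∷ _) σ d _ Δ≈ , _ , _) with ↭-empty-inv Δ≈
  ... | ()

  module _ (em : ExcludedMiddle 0ℓ) where
    branch : ℕ → Val
    branch zero    = λ _ → false
    branch (suc n) with em {Closed (branch n [ n ≔ true ]) (suc n)}
    ... | yes _ = branch n [ n ≔ false ]
    ... | no  _ = branch n [ n ≔ true ]

    branch-open : ¬ Der Ax ([] ⊢ []) → ∀ n → ¬ Closed (branch n) n
    branch-open ⊬ zero = λ c → ⊬ (closed-root c)
    branch-open ⊬ (suc n) with em {Closed (branch n [ n ≔ true ]) (suc n)}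
    ... | yes c₁ = λ c₀ → branch-open ⊬ n (clash (branch n) n (atomize c₁) (atomize c₀))
    ... | no ¬c₁ = ¬c₁

    branch-extends : ∀ m {c} → ¬ c ≡ m → branch (suc m) c ≡ branch m c
    branch-extends m c≢m with em {Closed (branch m [ m ≔ true ]) (suc m)}
    ... | yes _ = ≔-other _ m false c≢m
    ... | no  _ = ≔-other _ m true c≢m

    branch-stable : ∀ m c → c < m → branch m c ≡ branch (suc c) c
    branch-stable (suc m) c c<1+m with c ≟ m
    ... | yes refl = refl
    ... | no  c≢m  = trans (branch-extends m c≢m) (branch-stable m c (≤∧≢⇒< (≤-pred c<1+m) c≢m))

    limit : Val
    limit c = branch (suc c) c

    limit-model : ∀ F → ¬ Der Ax ([] ⊢ []) → (∀ a → Instance [] (F ⟨ a ⟩ ∷ [])) →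
                  ModelOf (herbrand limit) F
    limit-model F ⊬ instances a with value limit (F ⟨ a ⟩) in e
    ... | true  = trans (herbrand-eval limit a F) e
    ... | false = ⊥-elim (branch-open ⊬ N ([] , F ⟨ a ⟩ ∷ [] , instances a , [] , (lows , e′) ∷ []))
      where
      N = bound (codes (F ⟨ a ⟩))
      lows = below-bound (codes (F ⟨ a ⟩))
      e′ : value (branch N) (F ⟨ a ⟩) ≡ false
      e′ = trans (value-agree (branch N) limit N (F ⟨ a ⟩) (λ {c} → branch-stable N c) lows) e

-- every instance of ⊢ F is an instance of the axiom ⊢ F (identity renaming)
axiom-instances : ∀ F a → Lifting.Instance (renamed-shift F) [] (F ⟨ a ⟩ ∷ [])
axiom-instances F a = Lifting.inst [] (F ⟨ var ⟩ ∷ []) a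
  (axiom (var , ((λ x → x) , (λ e → e) , (λ _ → refl)) , refl)) ↭-refl (↭-reflexive (cong (_∷ []) (comp F)))

completeness : ExcludedMiddle 0ℓ → (F : Fml) → ¬ Satisfiable F → Der (RenamedAxioms F) ([] ⊢ [])
completeness em F unsat with em {Der (RenamedAxioms F) ([] ⊢ [])}
... | yes derivable = derivable
... | no  ⊬ = ⊥-elim (unsat (herbrand (limit em) , limit-model em F ⊬ (axiom-instances F)))
  where open SemanticTree (renamed-shift F)

proposition10 :
    (∀ {ps c} → Rule ps c → (𝔐 : Structure) → All (ModelOfSeq 𝔐) ps → ModelOfSeq 𝔐 c)
    ×
    (ExcludedMiddle 0ℓ → (F : Fml) → ¬ Satisfiable F → Der (RenamedAxioms F) ([] ⊢ []))
proposition10 = (λ r 𝔐 → sound 𝔐 r) , completeness
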